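{- For every $k\geq 5$, the $k$-fan is an interval graph but not a proper chordal graph.
   Context: For $k\ge3$, the $k$-fan is the graph obtained from a path on $k+1$ vertices by adding a new vertex adjacent to all vertices of the path. An interval graph is the intersection graph of a family of intervals of the real line. A tree-layout of $G=(V,E)$ is a triple $(T,r,\rho)$ with $T$ a tree on $|V|$ nodes rooted at $r$ and $\rho:V\to V(T)$ a bijection such that for every edge $xy$, $\rho(x)$ is an ancestor of $\rho(y)$ or vice versa; write $u\prec v$ if $\rho(u)$ is a proper ancestor of $\rho(v)$. $G$ is proper chordal if it admits a tree-layout with no three vertices $x\prec y\prec z$ such that $xz\in E$ and exactly one of $xy,yz$ is in $E$. -}

module Defs where

open import Data.Nat using (ℕ; zero; suc; _≤_)
open import Data.Fin using (Fin; zero; suc; toℕ)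
open import Data.Product using (Σ; ∃; _×_; _,_)
open import Data.Sum using (_⊎_)
open import Data.Unit using (⊤)
open import Data.Empty using (⊥)
open import Relation.Nullary using (¬_)
open import Relation.Binary.PropositionalEquality using (_≡_; _≢_)
open import Function.Bundles using (_⇔_; _⤖_; Bijection)

record Graph : Set₁ where
  field
    n     : ℕ
    Adj   : Fin n → Fin n → Set
    irrefl : ∀ x → ¬ Adj x x
    sym   : ∀ {x y} → Adj x y → Adj y x
open Graph public

-- The k-fan: vertex zero is the apex, vertices suc i (i : Fin (suc k))
-- form the path 0 - 1 - ... - k on k+1 vertices.

PathAdj : {m : ℕ} → Fin m → Fin m → Set
PathAdj i j = (toℕ i ≡ suc (toℕ j)) ⊎ (toℕ j ≡ suc (toℕ i))

FanAdj : (k : ℕ) → Fin (suc (suc k)) → Fin (suc (suc k)) → Set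
FanAdj k zero    zero    = ⊥
FanAdj k zero    (suc j) = ⊤
FanAdj k (suc i) zero    = ⊤
FanAdj k (suc i) (suc j) = PathAdj i j

private
  ≡-irr : ∀ {a : ℕ} → a ≡ suc a → ⊥
  ≡-irr {zero} ()
  ≡-irr {suc a} p = ≡-irr {a} (suc-inj p)
    where
      suc-inj : ∀ {x y : ℕ} → suc x ≡ suc y → x ≡ y
      suc-inj _≡_.refl = _≡_.refl

  fan-irrefl : ∀ k x → ¬ FanAdj k x x
  fan-irrefl k zero ()
  fan-irrefl k (suc i) (Data.Sum.inj₁ p) = ≡-irr p
  fan-irrefl k (suc i) (Data.Sum.inj₂ p) = ≡-irr p

  fan-sym : ∀ k {x y} → FanAdj k x y → FanAdj k y x
  fan-sym k {zero} {suc j} _ = Data.Unit.tt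
  fan-sym k {suc i} {zero} _ = Data.Unit.tt
  fan-sym k {suc i} {suc j} (Data.Sum.inj₁ p) = Data.Sum.inj₂ p
  fan-sym k {suc i} {suc j} (Data.Sum.inj₂ p) = Data.Sum.inj₁ p

fan : ℕ → Graph
fan k = record
  { n = suc (suc k) ; Adj = FanAdj k
  ; irrefl = fan-irrefl k ; sym = fan-sym k }

-- Interval graphs: each vertex gets a closed interval [l v, r v]; distinct
-- vertices are adjacent iff their intervals intersect.  (Finite interval
-- graphs can always be represented with natural-number endpoints.)

IsIntervalGraph : Graph → Set
IsIntervalGraph G =
  Σ (Fin (n G) → ℕ) λ l → Σ (Fin (n G) → ℕ) λ r →
    (∀ v → l v ≤ r v) ×
    (∀ x y → x ≢ y → (Adj G x y ⇔ (l x ≤ r y × l y ≤ r x)))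

iter : {A : Set} → (A → A) → ℕ → A → A
iter f zero    a = a
iter f (suc m) a = f (iter f m a)

record RootedTree (m : ℕ) : Set where
  field
    root        : Fin m
    parent      : Fin m → Fin m
    root-parent : parent root ≡ root
    reaches     : ∀ v → ∃ λ j → iter parent j v ≡ root
open RootedTree public

Ancestor : {m : ℕ} → RootedTree m → Fin m → Fin m → Set
Ancestor T a b = ∃ λ j → iter (parent T) j b ≡ a

ProperAncestor : {m : ℕ} → RootedTree m → Fin m → Fin m → Set
ProperAncestor T a b = Ancestor T a b × a ≢ b

-- Tree-layout (T, r, ρ) of G: T a rooted tree on |V| nodes (root r is a
-- field of T), ρ : V → V(T) a bijection, and every edge joins an
-- ancestor/descendant pair.
record TreeLayout (G : Graph) : Set where
  field
    tree   : RootedTree (n G)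
    ρ      : Fin (n G) ⤖ Fin (n G)
  ρf : Fin (n G) → Fin (n G)
  ρf = Bijection.to ρ
  field
    edges  : ∀ {x y} → Adj G x y →
             Ancestor tree (ρf x) (ρf y) ⊎ Ancestor tree (ρf y) (ρf x)

  _≺_ : Fin (n G) → Fin (n G) → Set
  u ≺ v = ProperAncestor tree (ρf u) (ρf v)
open TreeLayout public

ExactlyOne : Set → Set → Set
ExactlyOne P Q = (P × ¬ Q) ⊎ (¬ P × Q)

IsProperChordal : Graph → Set
IsProperChordal G = Σ (TreeLayout G) λ L →
  ∀ x y z → ¬ (_≺_ L x y × _≺_ L y z × Adj G x z × ExactlyOne (Adj G x y) (Adj G y z))

{-# OPTIONS --safe #-}
module Submission where

-- The apex is adjacent to every path vertex, so in a tree-layout each path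
-- vertex lies strictly above or strictly below it.  If the layout has no bad
-- triple, the vertices above the apex are pairwise adjacent, and a vertex
-- adjacent to two non-adjacent vertices below the apex is an ancestor of both.
-- Consequently no induced P₄ can have its last three vertices below the apex,
-- nor its middle edge above and both ends below.  Whichever sides the path
-- vertices 2 and 3 take, one of these configurations appears among the path
-- vertices 0, …, 5.  The interval model gives the apex [0, k+1] and path
-- vertex i the interval [i, i+1].

open import Defs hiding (sym; tree; ρ; ρf; edges; _≺_)
open import Data.Nat using (ℕ; zero; suc; _+_; _*_; _∸_; _≤_; _<_; z≤n; s≤s)
open import Data.Nat.Properties
  using (≤-refl; ≤-reflexive; ≤-trans; ≤-total; n≤1+n; m≤n⇒m≤1+n; 1+n≰n;
         <-irrefl; <-asym; +-comm; +-suc; *-suc; m∸n+n≡m)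
open import Data.Fin using (Fin; zero; suc; toℕ)
open import Data.Fin.Properties using (toℕ-injective; toℕ≤pred[n])
open import Data.Product using (_×_; _,_; proj₁; proj₂)
open import Data.Sum using (_⊎_; inj₁; inj₂)
import Data.Sum as Sum
open import Data.Unit using (tt)
open import Data.Empty using (⊥; ⊥-elim)
open import Relation.Nullary using (¬_)
open import Relation.Binary.PropositionalEquality
  using (_≡_; _≢_; refl; sym; trans; cong; subst; ≢-sym; module ≡-Reasoning)
open import Function using (_∘_; case_of_)
open import Function.Bundles using (_⇔_; mk⇔; Bijection)

adjacent⇔unit-intervals-meet : ∀ {i j} → i ≢ j →
  ((i ≡ suc j) ⊎ (j ≡ suc i)) ⇔ (i ≤ suc j × j ≤ suc i)
adjacent⇔unit-intervals-meet i≢j = mk⇔ to (from i≢j)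
  where
  to : ∀ {i j} → (i ≡ suc j) ⊎ (j ≡ suc i) → i ≤ suc j × j ≤ suc i
  to (inj₁ refl) = ≤-refl , m≤n⇒m≤1+n (n≤1+n _)
  to (inj₂ refl) = m≤n⇒m≤1+n (n≤1+n _) , ≤-refl

  from : ∀ {i j} → i ≢ j → i ≤ suc j × j ≤ suc i → (i ≡ suc j) ⊎ (j ≡ suc i)
  from {zero}        {zero}        i≢j _            = ⊥-elim (i≢j refl)
  from {zero}        {suc zero}    _   _            = inj₂ refl
  from {zero}        {suc (suc j)} _   (_ , s≤s ())
  from {suc zero}    {zero}        _   _            = inj₁ refl
  from {suc (suc i)} {zero}        _   (s≤s () , _)
  from {suc i}       {suc j}       i≢j (s≤s i≤1+j , s≤s j≤1+i) =
    Sum.map (cong suc) (cong suc) (from (i≢j ∘ cong suc) (i≤1+j , j≤1+i))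

fan-interval : ∀ k → IsIntervalGraph (fan k)
fan-interval k = left , right , left≤right , adjacent⇔meet
  where
  left right : Fin (suc (suc k)) → ℕ
  left  zero    = 0
  left  (suc i) = toℕ i
  right zero    = suc k
  right (suc i) = suc (toℕ i)

  left≤right : ∀ v → left v ≤ right v
  left≤right zero    = z≤n
  left≤right (suc i) = n≤1+n (toℕ i)

  path≤apex : (i : Fin (suc k)) → toℕ i ≤ suc k
  path≤apex i = m≤n⇒m≤1+n (toℕ≤pred[n] i)

  adjacent⇔meet : ∀ u v → u ≢ v → FanAdj k u v ⇔ (left u ≤ right v × left v ≤ right u)
  adjacent⇔meet zero    zero    u≢v = ⊥-elim (u≢v refl)
  adjacent⇔meet zero    (suc j) _   = mk⇔ (λ _ → z≤n , path≤apex j) (λ _ → tt)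
  adjacent⇔meet (suc i) zero    _   = mk⇔ (λ _ → path≤apex i , z≤n) (λ _ → tt)
  adjacent⇔meet (suc i) (suc j) u≢v =
    adjacent⇔unit-intervals-meet (u≢v ∘ cong suc ∘ toℕ-injective)

iter-+ : ∀ {A : Set} (f : A → A) m n a → iter f (m + n) a ≡ iter f m (iter f n a)
iter-+ f zero    n a = refl
iter-+ f (suc m) n a = cong f (iter-+ f m n a)

iter-fixed : ∀ {A : Set} (f : A → A) {a} → f a ≡ a → ∀ t → iter f t a ≡ a
iter-fixed f fa≡a zero    = refl
iter-fixed f fa≡a (suc t) = trans (cong f (iter-fixed f fa≡a t)) fa≡a

iter-periodic : ∀ {A : Set} (f : A → A) {a} p → iter f p a ≡ a → ∀ t → iter f (t * p) a ≡ a
iter-periodic f p fᵖa≡a zero    = refl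
iter-periodic f {a} p fᵖa≡a (suc t) = begin
  iter f (p + t * p) a        ≡⟨ iter-+ f p (t * p) a ⟩
  iter f p (iter f (t * p) a) ≡⟨ cong (iter f p) (iter-periodic f p fᵖa≡a t) ⟩
  iter f p a                  ≡⟨ fᵖa≡a ⟩
  a                           ∎
  where open ≡-Reasoning

iter-resume : ∀ {A : Set} (f : A → A) d s {a b c} →
              iter f s a ≡ b → iter f (d + s) a ≡ c → iter f d b ≡ c
iter-resume f d s {a} fˢa≡b fᵈ⁺ˢa≡c =
  trans (cong (iter f d) (sym fˢa≡b)) (trans (sym (iter-+ f d s a)) fᵈ⁺ˢa≡c)

module _ {m : ℕ} (T : RootedTree m) where
  private
    P : Fin m → Fin m
    P = parent T

  -- Iterating the period r times, where r steps lead v to the root, lands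
  -- both on v and on the root.
  periodic⇒root : ∀ {v} q → iter P (suc q) v ≡ v → v ≡ root T
  periodic⇒root {v} q periodic = begin
    v                              ≡⟨ iter-periodic P (suc q) periodic r ⟨
    iter P (r * suc q) v           ≡⟨ cong (λ t → iter P t v) (trans (*-suc r q) (+-comm r (r * q))) ⟩
    iter P (r * q + r) v           ≡⟨ iter-+ P (r * q) r v ⟩
    iter P (r * q) (iter P r v)    ≡⟨ cong (iter P (r * q)) v↝root ⟩
    iter P (r * q) (root T)        ≡⟨ iter-fixed P (root-parent T) (r * q) ⟩
    root T                         ∎
    where
    open ≡-Reasoning
    r : ℕ
    r = proj₁ (reaches T v)
    v↝root : iter P r v ≡ root T
    v↝root = proj₂ (reaches T v)

  ancestor-trans : ∀ {u v w} → Ancestor T u v → Ancestor T v w → Ancestor T u w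
  ancestor-trans {w = w} (i , v↝u) (j , w↝v) =
    i + j , trans (iter-+ P i j w) (trans (cong (iter P i) w↝v) v↝u)

  ancestor-antisym : ∀ {u v} → Ancestor T u v → Ancestor T v u → u ≡ v
  ancestor-antisym (zero  , v≡u) _ = sym v≡u
  ancestor-antisym {u} {v} (suc i , v↝u) (j , u↝v) = begin
    u                       ≡⟨ v↝u ⟨
    iter P (suc i) v        ≡⟨ cong (iter P (suc i)) v≡root ⟩
    iter P (suc i) (root T) ≡⟨ iter-fixed P (root-parent T) (suc i) ⟩
    root T                  ≡⟨ v≡root ⟨
    v                       ∎
    where
    open ≡-Reasoning
    cycle : iter P (j + suc i) v ≡ v
    cycle = trans (iter-+ P j (suc i) v) (trans (cong (iter P j) v↝u) u↝v)
    v≡root : v ≡ root T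
    v≡root = periodic⇒root (j + i) (subst (λ t → iter P t v ≡ v) (+-suc j i) cycle)

  ancestors-comparable : ∀ {u v w} → Ancestor T u w → Ancestor T v w →
                         Ancestor T u v ⊎ Ancestor T v u
  ancestors-comparable {w = w} (i , w↝u) (j , w↝v) with ≤-total i j
  ... | inj₁ i≤j = inj₂ (j ∸ i , iter-resume P (j ∸ i) i w↝u
                                   (subst (λ t → iter P t w ≡ _) (sym (m∸n+n≡m i≤j)) w↝v))
  ... | inj₂ j≤i = inj₁ (i ∸ j , iter-resume P (i ∸ j) j w↝v
                                   (subst (λ t → iter P t w ≡ _) (sym (m∸n+n≡m j≤i)) w↝u))

  proper-ancestor-trans : ∀ {u v w} → ProperAncestor T u v → ProperAncestor T v w →
                          ProperAncestor T u w
  proper-ancestor-trans {v = v} (u⊒v , u≢v) (v⊒w , _) =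
    ancestor-trans u⊒v v⊒w ,
    λ u≡w → u≢v (ancestor-antisym u⊒v (subst (Ancestor T v) (sym u≡w) v⊒w))

  proper-ancestor-asym : ∀ {u v} → ProperAncestor T u v → ¬ ProperAncestor T v u
  proper-ancestor-asym (u⊒v , u≢v) (v⊒u , _) = u≢v (ancestor-antisym u⊒v v⊒u)

adjacent⇒≢ : (G : Graph) → ∀ {x y} → Adj G x y → x ≢ y
adjacent⇒≢ G {x} x~y refl = irrefl G x x~y

module Layout {G : Graph} (L : TreeLayout G) where
  open TreeLayout L

  ≺-trans : ∀ {x y z} → x ≺ y → y ≺ z → x ≺ z
  ≺-trans = proper-ancestor-trans tree

  ≺-asym : ∀ {x y} → x ≺ y → ¬ y ≺ x
  ≺-asym = proper-ancestor-asym tree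

  ≺⇒≢ : ∀ {x y} → x ≺ y → x ≢ y
  ≺⇒≢ (_ , ρx≢ρy) x≡y = ρx≢ρy (cong ρf x≡y)

  ancestor⇒≺ : ∀ {x y} → x ≢ y → Ancestor tree (ρf x) (ρf y) → x ≺ y
  ancestor⇒≺ x≢y ρx⊒ρy = ρx⊒ρy , x≢y ∘ Bijection.injective ρ

  adjacent⇒comparable : ∀ {x y} → Adj G x y → x ≺ y ⊎ y ≺ x
  adjacent⇒comparable {x} {y} x~y =
    Sum.map (ancestor⇒≺ x≢y) (ancestor⇒≺ (≢-sym x≢y)) (edges x~y)
    where
    x≢y : x ≢ y
    x≢y = adjacent⇒≢ G x~y

  common-descendant⇒comparable : ∀ {x y z} → x ≺ z → y ≺ z → x ≢ y → x ≺ y ⊎ y ≺ x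
  common-descendant⇒comparable (ρx⊒ρz , _) (ρy⊒ρz , _) x≢y =
    Sum.map (ancestor⇒≺ x≢y) (ancestor⇒≺ (≢-sym x≢y))
            (ancestors-comparable tree ρx⊒ρz ρy⊒ρz)

NoBadTriple : {G : Graph} → TreeLayout G → Set
NoBadTriple {G} L = ∀ x y z →
  ¬ (x ≺ y × y ≺ z × Adj G x z × ExactlyOne (Adj G x y) (Adj G y z))
  where open TreeLayout L

Apart : (G : Graph) → Fin (n G) → Fin (n G) → Set
Apart G x y = x ≢ y × ¬ Adj G x y

apart-sym : (G : Graph) → ∀ {x y} → Apart G x y → Apart G y x
apart-sym G (x≢y , x≁y) = ≢-sym x≢y , x≁y ∘ Graph.sym G

record InducedP₄ (G : Graph) (w x y z : Fin (n G)) : Set where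
  field
    w~x : Adj G w x
    x~y : Adj G x y
    y~z : Adj G y z
    w≁y : Apart G w y
    x≁z : Apart G x z
    w≁z : Apart G w z
open InducedP₄

reverse : ∀ {G w x y z} → InducedP₄ G w x y z → InducedP₄ G z y x w
reverse {G} P = record
  { w~x = Graph.sym G (y~z P) ; x~y = Graph.sym G (x~y P) ; y~z = Graph.sym G (w~x P)
  ; w≁y = apart-sym G (x≁z P) ; x≁z = apart-sym G (w≁y P) ; w≁z = apart-sym G (w≁z P) }

module ApexLayout {G : Graph} (L : TreeLayout G) (good : NoBadTriple L)
                  (a : Fin (n G)) (universal : ∀ v → v ≢ a → Adj G a v) where
  open TreeLayout L using (_≺_)
  open Layout L

  position : ∀ v → v ≢ a → a ≺ v ⊎ v ≺ a
  position v v≢a = adjacent⇒comparable (universal v v≢a)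

  adjacent-to-below : ∀ {v} → a ≺ v → Adj G a v
  adjacent-to-below a≺v = universal _ (≢-sym (≺⇒≢ a≺v))

  adjacent-to-above : ∀ {v} → v ≺ a → Adj G v a
  adjacent-to-above v≺a = Graph.sym G (universal _ (≺⇒≢ v≺a))

  below-ordered⇒adjacent : ∀ {y z} → a ≺ y → y ≺ z → ¬ ¬ Adj G y z
  below-ordered⇒adjacent {y} {z} a≺y y≺z y≁z =
    good a y z (a≺y , y≺z , adjacent-to-below a≺z , inj₁ (adjacent-to-below a≺y , y≁z))
    where a≺z = ≺-trans a≺y y≺z

  above-ordered⇒adjacent : ∀ {x y} → x ≺ y → y ≺ a → ¬ ¬ Adj G x y
  above-ordered⇒adjacent {x} {y} x≺y y≺a x≁y =
    good x y a (x≺y , y≺a , adjacent-to-above (≺-trans x≺y y≺a) , inj₂ (x≁y , adjacent-to-above y≺a))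

  apart-below⇒incomparable : ∀ {y z} → a ≺ y → a ≺ z → Apart G y z → ¬ (y ≺ z ⊎ z ≺ y)
  apart-below⇒incomparable a≺y a≺z (_ , y≁z) (inj₁ y≺z) = below-ordered⇒adjacent a≺y y≺z y≁z
  apart-below⇒incomparable a≺y a≺z (_ , y≁z) (inj₂ z≺y) =
    below-ordered⇒adjacent a≺z z≺y (y≁z ∘ Graph.sym G)

  apart-from-above⇒below : ∀ {x y} → x ≺ a → Apart G x y → a ≺ y
  apart-from-above⇒below {x} {y} x≺a (x≢y , x≁y) = case position y y≢a of λ where
      (inj₁ a≺y) → a≺y
      (inj₂ y≺a) → ⊥-elim (case common-descendant⇒comparable x≺a y≺a x≢y of λ where
        (inj₁ x≺y) → above-ordered⇒adjacent x≺y y≺a x≁y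
        (inj₂ y≺x) → above-ordered⇒adjacent y≺x x≺a (x≁y ∘ Graph.sym G))
    where
    y≢a : y ≢ a
    y≢a refl = x≁y (adjacent-to-above x≺a)

  neighbour-of-apart-below⇒ancestor : ∀ {x y z} → a ≺ y → a ≺ z →
    Adj G x y → Adj G x z → Apart G y z → x ≺ y
  neighbour-of-apart-below⇒ancestor a≺y a≺z x~y x~z y≁z
    with adjacent⇒comparable x~y | adjacent⇒comparable x~z
  ... | inj₁ x≺y | _        = x≺y
  ... | inj₂ y≺x | inj₁ x≺z =
    ⊥-elim (apart-below⇒incomparable a≺y a≺z y≁z (inj₁ (≺-trans y≺x x≺z)))
  ... | inj₂ y≺x | inj₂ z≺x =
    ⊥-elim (apart-below⇒incomparable a≺y a≺z y≁z (common-descendant⇒comparable y≺x z≺x (proj₁ y≁z)))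

  P₄-with-tail-below : ∀ {w x y z} → InducedP₄ G w x y z → a ≺ x → a ≺ y → a ≺ z → ⊥
  P₄-with-tail-below {w} {x} {y} {z} P a≺x a≺y a≺z = case position w w≢a of λ where
      (inj₁ a≺w) → ≺-asym y≺x
        (neighbour-of-apart-below⇒ancestor a≺y a≺w (x~y P) (Graph.sym G (w~x P)) (apart-sym G (w≁y P)))
      (inj₂ w≺a) → good w y x
        (≺-trans w≺a a≺y , y≺x , w~x P , inj₂ (proj₂ (w≁y P) , Graph.sym G (x~y P)))
    where
    y≺x : y ≺ x
    y≺x = neighbour-of-apart-below⇒ancestor a≺x a≺z (Graph.sym G (x~y P)) (y~z P) (x≁z P)
    w≢a : w ≢ a
    w≢a refl = proj₂ (w≁y P) (adjacent-to-below a≺y)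

  P₄-with-middle-above : ∀ {w x y z} → InducedP₄ G w x y z → a ≺ w → x ≺ a → y ≺ a → a ≺ z → ⊥
  P₄-with-middle-above {w} {x} {y} {z} P a≺w x≺a y≺a a≺z
    with common-descendant⇒comparable x≺a y≺a (adjacent⇒≢ G (x~y P))
  ... | inj₁ x≺y = good x y w (x≺y , ≺-trans y≺a a≺w , Graph.sym G (w~x P) ,
                               inj₁ (x~y P , proj₂ (apart-sym G (w≁y P))))
  ... | inj₂ y≺x = good y x z (y≺x , ≺-trans x≺a a≺z , y~z P ,
                               inj₁ (Graph.sym G (x~y P) , proj₂ (x≁z P)))

apex-universal : ∀ k v → v ≢ zero → FanAdj k zero v
apex-universal k zero    v≢0 = ⊥-elim (v≢0 refl)
apex-universal k (suc i) _   = tt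

module _ {k : ℕ} where
  apart-on-path : ∀ {i j : Fin (suc k)} → 2 + toℕ i ≤ toℕ j → Apart (fan k) (suc i) (suc j)
  apart-on-path {i} {j} 2+i≤j = distinct , nonadjacent
    where
    i<j : toℕ i < toℕ j
    i<j = ≤-trans (n≤1+n _) 2+i≤j

    distinct : suc i ≢ suc j
    distinct refl = <-irrefl refl i<j

    nonadjacent : ¬ PathAdj i j
    nonadjacent (inj₁ i≡1+j) = <-asym i<j (≤-reflexive (sym i≡1+j))
    nonadjacent (inj₂ j≡1+i) = 1+n≰n (subst (2 + toℕ i ≤_) j≡1+i 2+i≤j)

  consecutive-on-path : ∀ {w x y z : Fin (suc k)} →
    toℕ x ≡ suc (toℕ w) → toℕ y ≡ suc (toℕ x) → toℕ z ≡ suc (toℕ y) →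
    InducedP₄ (fan k) (suc w) (suc x) (suc y) (suc z)
  consecutive-on-path {w} {x} {y} {z} x≡1+w y≡1+x z≡1+y = record
    { w~x = inj₂ x≡1+w ; x~y = inj₂ y≡1+x ; y~z = inj₂ z≡1+y
    ; w≁y = apart-on-path (≤-reflexive (sym (trans y≡1+x (cong suc x≡1+w))))
    ; x≁z = apart-on-path (≤-reflexive (sym (trans z≡1+y (cong suc y≡1+x))))
    ; w≁z = apart-on-path (≤-trans (n≤1+n _)
              (≤-reflexive (sym (trans z≡1+y (cong suc (trans y≡1+x (cong suc x≡1+w)))))))
    }

module FanLayout (m : ℕ) (L : TreeLayout (fan (5 + m))) (good : NoBadTriple L) where
  open TreeLayout L using (_≺_)
  open ApexLayout L good zero (apex-universal (5 + m))

  p₀ p₁ p₂ p₃ p₄ p₅ : Fin (7 + m)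
  p₀ = suc zero
  p₁ = suc (suc zero)
  p₂ = suc (suc (suc zero))
  p₃ = suc (suc (suc (suc zero)))
  p₄ = suc (suc (suc (suc (suc zero))))
  p₅ = suc (suc (suc (suc (suc (suc zero)))))

  P₀₁₂₃ : InducedP₄ (fan (5 + m)) p₀ p₁ p₂ p₃
  P₀₁₂₃ = consecutive-on-path refl refl refl

  P₁₂₃₄ : InducedP₄ (fan (5 + m)) p₁ p₂ p₃ p₄
  P₁₂₃₄ = consecutive-on-path refl refl refl

  P₂₃₄₅ : InducedP₄ (fan (5 + m)) p₂ p₃ p₄ p₅
  P₂₃₄₅ = consecutive-on-path refl refl refl

  impossible : ⊥
  impossible with position p₂ (λ ()) | position p₃ (λ ())
  ... | inj₂ ↑₂ | inj₂ ↑₃ =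
    P₄-with-middle-above P₁₂₃₄ ↓₁ ↑₂ ↑₃ ↓₄
    where
    ↓₁ : zero ≺ p₁
    ↓₁ = apart-from-above⇒below ↑₃ (apart-sym (fan (5 + m)) (w≁y P₁₂₃₄))
    ↓₄ : zero ≺ p₄
    ↓₄ = apart-from-above⇒below ↑₂ (x≁z P₁₂₃₄)
  ... | inj₂ ↑₂ | inj₁ ↓₃ =
    P₄-with-tail-below P₂₃₄₅ ↓₃ ↓₄ ↓₅
    where
    ↓₄ : zero ≺ p₄
    ↓₄ = apart-from-above⇒below ↑₂ (w≁y P₂₃₄₅)
    ↓₅ : zero ≺ p₅
    ↓₅ = apart-from-above⇒below ↑₂ (w≁z P₂₃₄₅)
  ... | inj₁ ↓₂ | inj₂ ↑₃ =
    P₄-with-tail-below (reverse P₀₁₂₃) ↓₂ ↓₁ ↓₀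
    where
    ↓₁ : zero ≺ p₁
    ↓₁ = apart-from-above⇒below ↑₃ (w≁y (reverse P₀₁₂₃))
    ↓₀ : zero ≺ p₀
    ↓₀ = apart-from-above⇒below ↑₃ (w≁z (reverse P₀₁₂₃))
  ... | inj₁ ↓₂ | inj₁ ↓₃ with position p₁ (λ ())
  ...   | inj₁ ↓₁ = P₄-with-tail-below P₀₁₂₃ ↓₁ ↓₂ ↓₃
  ...   | inj₂ ↑₁ = P₄-with-tail-below P₁₂₃₄ ↓₂ ↓₃ (apart-from-above⇒below ↑₁ (w≁z P₁₂₃₄))

fan-not-proper-chordal : ∀ {k} → 5 ≤ k → ¬ IsProperChordal (fan k)
fan-not-proper-chordal {suc (suc (suc (suc (suc m))))} (s≤s (s≤s (s≤s (s≤s (s≤s _))))) (L , good) =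
  FanLayout.impossible m L good

mainTheorem16 : (k : ℕ) → 5 ≤ k → IsIntervalGraph (fan k) × ¬ IsProperChordal (fan k)
mainTheorem16 k 5≤k = fan-interval k , fan-not-proper-chordal 5≤k
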